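{- For every proposition formula $f$ and every Boolean equation system $\mathcal{E}$, the structure graph $\langle\mathcal{E},f\rangle$ is BESsy.
   Context: Proposition formulae: $f::=\mathsf{true}\mid\mathsf{false}\mid X\mid f\wedge f\mid f\vee f$. A Boolean equation system (BES) is a finite sequence $\mathcal{E}=(\sigma_1X_1=f_1)\cdots(\sigma_nX_n=f_n)$, $\sigma_i\in\{\mu,\nu\}$, $X_i$ pairwise distinct; $\mathsf{bnd}(\mathcal{E})=\{X_1,\dots,X_n\}$. Rank: $\mathsf{rank}_{(\sigma Y=f)\mathcal{E}}(X)=\mathsf{rank}_{\mathcal{E}}(X)$ if $X\neq Y$, $=\mathsf{block}_\sigma(\mathcal{E})$ if $X=Y$, where $\mathsf{block}_\sigma(\epsilon)=0$ if $\sigma=\nu$, $1$ if $\sigma=\mu$, and $\mathsf{block}_\sigma((\sigma'Y=f)\mathcal{E})=\mathsf{block}_\sigma(\mathcal{E})$ if $\sigma=\sigma'$, else $1+\mathsf{block}_{\sigma'}(\mathcal{E})$. A structure graph is a tuple $\langle T,t,\to,d,r,\nearrow\rangle$: finite vertex set $T$, root $t$, edges $\to\subseteq T\times T$, partial decoration map $d:T\to\{\blacktriangle,\blacktriangledown,\top,\bot\}$, partial rank map $r:T\to\mathbb{N}$, partial free-variable map $\nearrow$ into proposition variables. It is BESsy if: (i) a vertex decorated $\top$ or $\bot$ or having a free-variable label has no successor; (ii) a vertex is decorated $\blacktriangle$ or $\blacktriangledown$ or has a rank iff it has a successor; (iii) a vertex with more than one successor is decorated $\blacktriangle$ or $\blacktriangledown$;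 (iv) every cycle contains a vertex with a rank. For a BES $\mathcal{E}$, the structure graph on vertices $\langle\mathcal{E},g\rangle$ is: $\langle\mathcal{E},X\rangle$ has free-variable label $X$ iff $X\notin\mathsf{bnd}(\mathcal{E})$, and rank $\mathsf{rank}_{\mathcal{E}}(X)$ iff $X\in\mathsf{bnd}(\mathcal{E})$; no other vertex is labelled or ranked. $\langle\mathcal{E},\mathsf{true}\rangle$ is $\top$, $\langle\mathcal{E},\mathsf{false}\rangle$ is $\bot$, conjunctions are $\blacktriangle$, disjunctions are $\blacktriangledown$; for bound $X$ with equation $\sigma X=g$, $\langle\mathcal{E},X\rangle$ is $\blacktriangle$ (resp. $\blacktriangledown$) if $g$ is a conjunction (resp. disjunction), else undecorated. Edges: for each operand $h$ of $g\wedge g'$, if $h$ is a conjunction then $\langle\mathcal{E},g\wedge g'\rangle$ has edges to all successors of $\langle\mathcal{E},h\rangle$, else an edge to $\langle\mathcal{E},h\rangle$; symmetrically for $\vee$. For bound $X$ with $\sigma X=g$: if $g$ is a conjunction or disjunction, $\langle\mathcal{E},X\rangle$ has edges to all successors of $\langle\mathcal{E},g\rangle$, else a single edge to $\langle\mathcal{E},g\rangle$. $\mathsf{true}$, $\mathsf{false}$ and free-variable vertices have no edges. $\langle\mathcal{E},f\rangle$ denotes the part reachable from $\langle\mathcal{E},f\rangle$, rooted there. -}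

module Defs where

open import Data.Nat using (ℕ; zero; suc; _≟_)
open import Data.Bool using (Bool; true; false; if_then_else_)
open import Data.Maybe using (Maybe; just; nothing)
open import Data.Product using (Σ; ∃; _×_; _,_)
open import Data.Sum using (_⊎_)
open import Data.List using (List; []; _∷_; map)
open import Data.List.Membership.Propositional using (_∈_)
open import Data.List.Relation.Unary.Any using (Any)
open import Relation.Nullary using (¬_; yes; no)
open import Relation.Binary.PropositionalEquality using (_≡_)
open import Function.Bundles using (_⇔_)

Var : Set
Var = ℕ

infixr 6 _∧_
infixr 5 _∨_

data Form : Set where
  tt ff : Form
  var   : Var → Form
  _∧_   : Form → Form → Form
  _∨_   : Form → Form → Form

isConj : Form → Bool
isConj (_ ∧ _) = true
isConj _       = false

isDisj : Form → Bool
isDisj (_ ∨ _) = true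
isDisj _       = false

data Sign : Set where
  μ ν : Sign

sameSign : Sign → Sign → Bool
sameSign μ μ = true
sameSign ν ν = true
sameSign _ _ = false

record Equation : Set where
  constructor eqn
  field
    sign : Sign
    lhs  : Var
    rhs  : Form
open Equation public

-- A BES is a finite sequence of equations; the requirement that the
-- left-hand sides are pairwise distinct is imposed as a hypothesis
-- (Unique (bnd E)) in the theorem.
BES : Set
BES = List Equation

bnd : BES → List Var
bnd = map lhs

block : Sign → BES → ℕ
block ν [] = 0
block μ [] = 1
block σ (eqn σ' _ _ ∷ E) = if sameSign σ σ' then block σ E else suc (block σ' E)

rank : BES → Var → Maybe ℕ
rank [] X = nothing
rank (eqn σ Y _ ∷ E) X with X ≟ Y
... | yes _ = just (block σ E)
... | no  _ = rank E X

-- the right-hand side of the (first, hence unique) equation for X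
lookupEq : BES → Var → Maybe (Sign × Form)
lookupEq [] X = nothing
lookupEq (eqn σ Y g ∷ E) X with X ≟ Y
... | yes _ = just (σ , g)
... | no  _ = lookupEq E X

-- Structure graphs (vertex set given as a type; the graph proper is the
-- part reachable from the root).

data Deco : Set where
  ▲ ▼ ⊤ ⊥ : Deco

record StructureGraph : Set₁ where
  field
    V     : Set
    root  : V
    _⟶_   : V → V → Set
    deco  : V → Maybe Deco
    rnk   : V → Maybe ℕ
    free  : V → Maybe Var

module _ (G : StructureGraph) where
  open StructureGraph G

  data Reach : V → Set where
    here : Reach root
    step : ∀ {u v} → Reach u → u ⟶ v → Reach v

  -- Walk u w vs : a non-empty walk from u to w whose vertices, except
  -- the final w, are listed in vs (in order).
  data Walk : V → V → List V → Set where
    edge : ∀ {u w} → u ⟶ w → Walk u w (u ∷ [])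
    cons : ∀ {u u' w vs} → u ⟶ u' → Walk u' w vs → Walk u (w) (u ∷ vs)

  HasRank : V → Set
  HasRank v = ∃ λ n → rnk v ≡ just n

  HasFree : V → Set
  HasFree v = ∃ λ x → free v ≡ just x

  IsFinite : Set
  IsFinite = ∃ λ (vs : List V) → ∀ v → Reach v → v ∈ vs

  record BESsy : Set where
    field
      cond-i   : ∀ v → Reach v →
                 (deco v ≡ just ⊤ ⊎ deco v ≡ just ⊥ ⊎ HasFree v) →
                 ∀ w → ¬ (v ⟶ w)
      cond-ii  : ∀ v → Reach v →
                 (deco v ≡ just ▲ ⊎ deco v ≡ just ▼ ⊎ HasRank v) ⇔
                 (∃ λ w → v ⟶ w)
      cond-iii : ∀ v → Reach v → ∀ w₁ w₂ → v ⟶ w₁ → v ⟶ w₂ → ¬ (w₁ ≡ w₂) →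
                 deco v ≡ just ▲ ⊎ deco v ≡ just ▼
      cond-iv  : ∀ v vs → Reach v → Walk v v vs → Any HasRank vs

-- The structure graph ⟨E , f⟩: vertices ⟨E , g⟩ are formulae g.

isBound : BES → Var → Bool
isBound E X with lookupEq E X
... | just _  = true
... | nothing = false

sgDeco : BES → Form → Maybe Deco
sgDeco E tt      = just ⊤
sgDeco E ff      = just ⊥
sgDeco E (_ ∧ _) = just ▲
sgDeco E (_ ∨ _) = just ▼
sgDeco E (var X) with lookupEq E X
... | just (_ , (_ ∧ _)) = just ▲
... | just (_ , (_ ∨ _)) = just ▼
... | _                  = nothing

sgRank : BES → Form → Maybe ℕ
sgRank E (var X) = rank E X     -- defined iff X ∈ bnd E
sgRank E _       = nothing

sgFree : BES → Form → Maybe Var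
sgFree E (var X) with lookupEq E X
... | just _  = nothing
... | nothing = just X
sgFree E _ = nothing

isJunct : Form → Bool
isJunct g = if isConj g then true else isDisj g

data Edge (E : BES) : Form → Form → Set where
  ∧ˡ-flat : ∀ {g g' k} → isConj g ≡ true  → Edge E g k → Edge E (g ∧ g') k
  ∧ˡ      : ∀ {g g'}   → isConj g ≡ false → Edge E (g ∧ g') g
  ∧ʳ-flat : ∀ {g g' k} → isConj g' ≡ true  → Edge E g' k → Edge E (g ∧ g') k
  ∧ʳ      : ∀ {g g'}   → isConj g' ≡ false → Edge E (g ∧ g') g'
  ∨ˡ-flat : ∀ {g g' k} → isDisj g ≡ true  → Edge E g k → Edge E (g ∨ g') k
  ∨ˡ      : ∀ {g g'}   → isDisj g ≡ false → Edge E (g ∨ g') g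
  ∨ʳ-flat : ∀ {g g' k} → isDisj g' ≡ true  → Edge E g' k → Edge E (g ∨ g') k
  ∨ʳ      : ∀ {g g'}   → isDisj g' ≡ false → Edge E (g ∨ g') g'
  var-flat : ∀ {X σ g k} → lookupEq E X ≡ just (σ , g) → isJunct g ≡ true →
             Edge E g k → Edge E (var X) k
  var-edge : ∀ {X σ g} → lookupEq E X ≡ just (σ , g) → isJunct g ≡ false →
             Edge E (var X) g

⟨_,_⟩ : BES → Form → StructureGraph
⟨ E , f ⟩ = record
  { V = Form ; root = f ; _⟶_ = Edge E
  ; deco = sgDeco E ; rnk = sgRank E ; free = sgFree E }

module Submission where

-- Every vertex reachable from f is a subformula of f or of a
-- right-hand side of E, which gives finiteness.  Every edge either leaves
-- a bound variable (a ranked vertex) or goes from a conjunction or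
-- disjunction to a strictly smaller formula; so along a cycle the formula
-- size cannot decrease at every step, and some vertex of the cycle is
-- ranked (condition iv).  Conditions i-iii are local: a vertex has a
-- successor exactly when it is a conjunction, a disjunction, or a bound
-- variable, and these are precisely the decorated-▲/▼ or ranked vertices.

open import Defs
open import Data.Product using (_×_)
open import Data.List.Relation.Unary.Unique.Propositional using (Unique)

open import Data.Nat using (ℕ; suc; _+_; _<_; _≟_; s≤s)
open import Data.Nat.Properties using (m≤m+n; m≤n+m; <-trans; <-irrefl)
open import Data.Bool using (true)
open import Data.Maybe using (Maybe; just; nothing)
open import Data.Maybe.Properties using (just-injective)
open import Data.Product using (∃; ∃₂; _,_; proj₁; proj₂)
import Data.Product as Product
open import Data.Sum using (_⊎_; inj₁; inj₂; [_,_]′)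
import Data.Sum as Sum
open import Data.List using (List; []; _∷_; _++_)
open import Data.List.Membership.Propositional using (_∈_)
open import Data.List.Membership.Propositional.Properties using (∈-++⁺ˡ; ∈-++⁺ʳ)
open import Data.List.Relation.Unary.Any using (Any; here; there)
open import Data.Empty using (⊥-elim)
open import Relation.Nullary using (¬_; yes; no)
open import Relation.Binary.PropositionalEquality using (_≡_; _≢_; refl; sym; trans; cong; subst)
open import Function using (case_of_)
open import Function.Bundles using (mk⇔)

size : Form → ℕ
size (a ∧ b) = suc (size a + size b)
size (a ∨ b) = suc (size a + size b)
size _       = 1

<-operandˡ : ∀ a b → size a < suc (size a + size b)
<-operandˡ a b = s≤s (m≤m+n (size a) (size b))

<-operandʳ : ∀ a b → size b < suc (size a + size b)
<-operandʳ a b = s≤s (m≤n+m (size b) (size a))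

data Sub : Form → Form → Set where
  sub-refl : ∀ {g} → Sub g g
  sub-∧ˡ   : ∀ {k a b} → Sub k a → Sub k (a ∧ b)
  sub-∧ʳ   : ∀ {k a b} → Sub k b → Sub k (a ∧ b)
  sub-∨ˡ   : ∀ {k a b} → Sub k a → Sub k (a ∨ b)
  sub-∨ʳ   : ∀ {k a b} → Sub k b → Sub k (a ∨ b)

sub-trans : ∀ {a b c} → Sub a b → Sub b c → Sub a c
sub-trans s sub-refl   = s
sub-trans s (sub-∧ˡ t) = sub-∧ˡ (sub-trans s t)
sub-trans s (sub-∧ʳ t) = sub-∧ʳ (sub-trans s t)
sub-trans s (sub-∨ˡ t) = sub-∨ˡ (sub-trans s t)
sub-trans s (sub-∨ʳ t) = sub-∨ʳ (sub-trans s t)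

subformulae : Form → List Form
subformulae (a ∧ b) = (a ∧ b) ∷ subformulae a ++ subformulae b
subformulae (a ∨ b) = (a ∨ b) ∷ subformulae a ++ subformulae b
subformulae g       = g ∷ []

Sub⇒∈subformulae : ∀ {k g} → Sub k g → k ∈ subformulae g
Sub⇒∈subformulae {g = tt}    sub-refl = here refl
Sub⇒∈subformulae {g = ff}    sub-refl = here refl
Sub⇒∈subformulae {g = var _} sub-refl = here refl
Sub⇒∈subformulae {g = _ ∧ _} sub-refl = here refl
Sub⇒∈subformulae {g = _ ∨ _} sub-refl = here refl
Sub⇒∈subformulae (sub-∧ˡ s) = there (∈-++⁺ˡ (Sub⇒∈subformulae s))
Sub⇒∈subformulae {g = a ∧ _} (sub-∧ʳ s) =
  there (∈-++⁺ʳ (subformulae a) (Sub⇒∈subformulae s))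
Sub⇒∈subformulae (sub-∨ˡ s) = there (∈-++⁺ˡ (Sub⇒∈subformulae s))
Sub⇒∈subformulae {g = a ∨ _} (sub-∨ʳ s) =
  there (∈-++⁺ʳ (subformulae a) (Sub⇒∈subformulae s))

bound⇒ranked : ∀ E {X p} → lookupEq E X ≡ just p → ∃ λ n → rank E X ≡ just n
bound⇒ranked [] ()
bound⇒ranked (eqn σ Y g ∷ E) {X} eq with X ≟ Y
... | yes _ = _ , refl
... | no  _ = bound⇒ranked E eq

ranked⇒bound : ∀ E {X n} → rank E X ≡ just n → ∃ λ p → lookupEq E X ≡ just p
ranked⇒bound [] ()
ranked⇒bound (eqn σ Y g ∷ E) {X} eq with X ≟ Y
... | yes _ = _ , refl
... | no  _ = ranked⇒bound E eq

rhs-unique : ∀ E {X σ σ' g g'} →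
             lookupEq E X ≡ just (σ , g) → lookupEq E X ≡ just (σ' , g') → g ≡ g'
rhs-unique E eq eq' = cong proj₂ (just-injective (trans (sym eq) eq'))

rhsSubformulae : BES → List Form
rhsSubformulae []      = []
rhsSubformulae (e ∷ E) = subformulae (rhs e) ++ rhsSubformulae E

lookup⇒∈rhsSubformulae : ∀ E {X σ g k} → lookupEq E X ≡ just (σ , g) →
                         Sub k g → k ∈ rhsSubformulae E
lookup⇒∈rhsSubformulae [] ()
lookup⇒∈rhsSubformulae (eqn σ Y g ∷ E) {X} eq s with X ≟ Y
lookup⇒∈rhsSubformulae (eqn σ Y g ∷ E) refl s | yes _ = ∈-++⁺ˡ (Sub⇒∈subformulae s)
... | no _ = ∈-++⁺ʳ (subformulae g) (lookup⇒∈rhsSubformulae E eq s)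

module _ (G : StructureGraph) where
  open StructureGraph G

  reach-invariant : (P : V → Set) → P root → (∀ {u v} → P u → u ⟶ v → P v) →
                    ∀ {v} → Reach G v → P v
  reach-invariant P p₀ closed here       = p₀
  reach-invariant P p₀ closed (step r e) = closed (reach-invariant P p₀ closed r) e

  finite-by-invariant : (P : V → Set) (vs : List V) → P root →
                        (∀ {u v} → P u → u ⟶ v → P v) → (∀ {v} → P v → v ∈ vs) →
                        IsFinite G
  finite-by-invariant P vs p₀ closed listed =
    vs , λ v r → listed (reach-invariant P p₀ closed r)

  module _ (m : V → ℕ) (ranked-or-descends : ∀ {u v} → u ⟶ v → HasRank G u ⊎ m v < m u) where

    walk-ranked-or-descends : ∀ {u w vs} → Walk G u w vs → Any (HasRank G) vs ⊎ m w < m u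
    walk-ranked-or-descends (edge e) = Sum.map₁ here (ranked-or-descends e)
    walk-ranked-or-descends (cons e p) with ranked-or-descends e | walk-ranked-or-descends p
    ... | inj₁ ranked | _          = inj₁ (here ranked)
    ... | inj₂ _      | inj₁ any   = inj₁ (there any)
    ... | inj₂ lt     | inj₂ lt'   = inj₂ (<-trans lt' lt)

    cycles-ranked : ∀ {v vs} → Walk G v v vs → Any (HasRank G) vs
    cycles-ranked p = [ (λ any → any) , (λ lt → ⊥-elim (<-irrefl refl lt)) ]′
                        (walk-ranked-or-descends p)

data Compound : Form → Set where
  conj : ∀ {a b} → Compound (a ∧ b)
  disj : ∀ {a b} → Compound (a ∨ b)

conj⇒compound : ∀ {g} → isConj g ≡ true → Compound g
conj⇒compound {_ ∧ _} _ = conj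

disj⇒compound : ∀ {g} → isDisj g ≡ true → Compound g
disj⇒compound {_ ∨ _} _ = disj

rhsDeco : Form → Maybe Deco
rhsDeco (_ ∧ _) = just ▲
rhsDeco (_ ∨ _) = just ▼
rhsDeco _       = nothing

IsBranch : Maybe Deco → Set
IsBranch d = d ≡ just ▲ ⊎ d ≡ just ▼

rhsDeco-notLeaf : ∀ g → rhsDeco g ≢ just ⊤ × rhsDeco g ≢ just ⊥
rhsDeco-notLeaf tt      = (λ ()) , (λ ())
rhsDeco-notLeaf ff      = (λ ()) , (λ ())
rhsDeco-notLeaf (var _) = (λ ()) , (λ ())
rhsDeco-notLeaf (_ ∧ _) = (λ ()) , (λ ())
rhsDeco-notLeaf (_ ∨ _) = (λ ()) , (λ ())

junction-branch : ∀ g → isJunct g ≡ true → IsBranch (rhsDeco g)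
junction-branch (_ ∧ _) _ = inj₁ refl
junction-branch (_ ∨ _) _ = inj₂ refl

module StructureGraphOf (E : BES) where

  Ranked : Form → Set
  Ranked v = ∃ λ n → sgRank E v ≡ just n

  Leaf : Form → Set
  Leaf v = sgDeco E v ≡ just ⊤ ⊎ sgDeco E v ≡ just ⊥ ⊎ (∃ λ x → sgFree E v ≡ just x)

  data InRhs (k : Form) : Set where
    in-rhs : ∀ {X σ g} → lookupEq E X ≡ just (σ , g) → Sub k g → InRhs k

  boundDeco : ∀ {X σ} g → lookupEq E X ≡ just (σ , g) → sgDeco E (var X) ≡ rhsDeco g
  boundDeco tt      eq rewrite eq = refl
  boundDeco ff      eq rewrite eq = refl
  boundDeco (var _) eq rewrite eq = refl
  boundDeco (_ ∧ _) eq rewrite eq = refl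
  boundDeco (_ ∨ _) eq rewrite eq = refl

  boundFree : ∀ {X p} → lookupEq E X ≡ just p → sgFree E (var X) ≡ nothing
  boundFree eq rewrite eq = refl

  boundNotLeaf : ∀ {X σ g} → lookupEq E X ≡ just (σ , g) → ¬ Leaf (var X)
  boundNotLeaf {g = g} eq (inj₁ isTop) =
    proj₁ (rhsDeco-notLeaf g) (trans (sym (boundDeco g eq)) isTop)
  boundNotLeaf {g = g} eq (inj₂ (inj₁ isBot)) =
    proj₂ (rhsDeco-notLeaf g) (trans (sym (boundDeco g eq)) isBot)
  boundNotLeaf eq (inj₂ (inj₂ (_ , isFree))) =
    case trans (sym (boundFree eq)) isFree of λ ()

  decorated⇒bound : ∀ {X} → IsBranch (sgDeco E (var X)) → ∃₂ λ σ g → lookupEq E X ≡ just (σ , g)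
  decorated⇒bound {X} d with lookupEq E X
  ... | just (σ , g) = σ , g , refl
  decorated⇒bound (inj₁ ()) | nothing
  decorated⇒bound (inj₂ ()) | nothing

  conjSucc : ∀ a b → ∃ (Edge E (a ∧ b))
  conjSucc (a ∧ a') b = Product.map₂ (∧ˡ-flat refl) (conjSucc a a')
  conjSucc tt       b = _ , ∧ˡ refl
  conjSucc ff       b = _ , ∧ˡ refl
  conjSucc (var _)  b = _ , ∧ˡ refl
  conjSucc (_ ∨ _)  b = _ , ∧ˡ refl

  disjSucc : ∀ a b → ∃ (Edge E (a ∨ b))
  disjSucc (a ∨ a') b = Product.map₂ (∨ˡ-flat refl) (disjSucc a a')
  disjSucc tt       b = _ , ∨ˡ refl
  disjSucc ff       b = _ , ∨ˡ refl
  disjSucc (var _)  b = _ , ∨ˡ refl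
  disjSucc (_ ∧ _)  b = _ , ∨ˡ refl

  boundSucc : ∀ {X σ} g → lookupEq E X ≡ just (σ , g) → ∃ (Edge E (var X))
  boundSucc (a ∧ b) eq = Product.map₂ (var-flat eq refl) (conjSucc a b)
  boundSucc (a ∨ b) eq = Product.map₂ (var-flat eq refl) (disjSucc a b)
  boundSucc tt      eq = _ , var-edge eq refl
  boundSucc ff      eq = _ , var-edge eq refl
  boundSucc (var _) eq = _ , var-edge eq refl

  compound-shrinks : ∀ {u k} → Compound u → Edge E u k → size k < size u
  compound-shrinks {a ∧ b} _ (∧ˡ-flat c e) = <-trans (compound-shrinks (conj⇒compound c) e) (<-operandˡ a b)
  compound-shrinks {a ∧ b} _ (∧ˡ _)        = <-operandˡ a b
  compound-shrinks {a ∧ b} _ (∧ʳ-flat c e) = <-trans (compound-shrinks (conj⇒compound c) e) (<-operandʳ a b)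
  compound-shrinks {a ∧ b} _ (∧ʳ _)        = <-operandʳ a b
  compound-shrinks {a ∨ b} _ (∨ˡ-flat d e) = <-trans (compound-shrinks (disj⇒compound d) e) (<-operandˡ a b)
  compound-shrinks {a ∨ b} _ (∨ˡ _)        = <-operandˡ a b
  compound-shrinks {a ∨ b} _ (∨ʳ-flat d e) = <-trans (compound-shrinks (disj⇒compound d) e) (<-operandʳ a b)
  compound-shrinks {a ∨ b} _ (∨ʳ _)        = <-operandʳ a b

  ranked-or-shrinks : ∀ {u k} → Edge E u k → Ranked u ⊎ size k < size u
  ranked-or-shrinks {_ ∧ _} e                 = inj₂ (compound-shrinks conj e)
  ranked-or-shrinks {_ ∨ _} e                 = inj₂ (compound-shrinks disj e)
  ranked-or-shrinks {var _} (var-flat eq _ _) = inj₁ (bound⇒ranked E eq)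
  ranked-or-shrinks {var _} (var-edge eq _)   = inj₁ (bound⇒ranked E eq)

  edge-target : ∀ {u k} → Edge E u k → Sub k u ⊎ InRhs k
  edge-target (∧ˡ-flat _ e) = Sum.map₁ sub-∧ˡ (edge-target e)
  edge-target (∧ˡ _)        = inj₁ (sub-∧ˡ sub-refl)
  edge-target (∧ʳ-flat _ e) = Sum.map₁ sub-∧ʳ (edge-target e)
  edge-target (∧ʳ _)        = inj₁ (sub-∧ʳ sub-refl)
  edge-target (∨ˡ-flat _ e) = Sum.map₁ sub-∨ˡ (edge-target e)
  edge-target (∨ˡ _)        = inj₁ (sub-∨ˡ sub-refl)
  edge-target (∨ʳ-flat _ e) = Sum.map₁ sub-∨ʳ (edge-target e)
  edge-target (∨ʳ _)        = inj₁ (sub-∨ʳ sub-refl)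
  edge-target (var-flat eq _ e) = inj₂ ([ in-rhs eq , (λ r → r) ]′ (edge-target e))
  edge-target (var-edge eq _)   = inj₂ (in-rhs eq sub-refl)

  Closure : Form → Form → Set
  Closure f v = Sub v f ⊎ InRhs v

  closure-closed : ∀ {f u v} → Closure f u → Edge E u v → Closure f v
  closure-closed c e with edge-target e
  ... | inj₂ r = inj₂ r
  closure-closed (inj₁ s)             _ | inj₁ t = inj₁ (sub-trans t s)
  closure-closed (inj₂ (in-rhs eq s)) _ | inj₁ t = inj₂ (in-rhs eq (sub-trans t s))

  closure-listed : ∀ {f v} → Closure f v → v ∈ subformulae f ++ rhsSubformulae E
  closure-listed (inj₁ s)                 = ∈-++⁺ˡ (Sub⇒∈subformulae s)
  closure-listed {f} (inj₂ (in-rhs eq s)) = ∈-++⁺ʳ (subformulae f) (lookup⇒∈rhsSubformulae E eq s)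

  leaf-sink : ∀ {v w} → Edge E v w → ¬ Leaf v
  leaf-sink {_ ∧ _} _ (inj₁ ())
  leaf-sink {_ ∧ _} _ (inj₂ (inj₁ ()))
  leaf-sink {_ ∧ _} _ (inj₂ (inj₂ (_ , ())))
  leaf-sink {_ ∨ _} _ (inj₁ ())
  leaf-sink {_ ∨ _} _ (inj₂ (inj₁ ()))
  leaf-sink {_ ∨ _} _ (inj₂ (inj₂ (_ , ())))
  leaf-sink {var _} (var-flat eq _ _) = boundNotLeaf eq
  leaf-sink {var _} (var-edge eq _)   = boundNotLeaf eq

  Labelled : Form → Set
  Labelled v = sgDeco E v ≡ just ▲ ⊎ sgDeco E v ≡ just ▼ ⊎ Ranked v

  labelled⇒succ : ∀ v → Labelled v → ∃ (Edge E v)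
  labelled⇒succ (a ∧ b) _ = conjSucc a b
  labelled⇒succ (a ∨ b) _ = disjSucc a b
  labelled⇒succ (var X) (inj₁ ▲-deco) with decorated⇒bound (inj₁ ▲-deco)
  ... | _ , g , eq = boundSucc g eq
  labelled⇒succ (var X) (inj₂ (inj₁ ▼-deco)) with decorated⇒bound (inj₂ ▼-deco)
  ... | _ , g , eq = boundSucc g eq
  labelled⇒succ (var X) (inj₂ (inj₂ (_ , r))) with ranked⇒bound E r
  ... | (_ , g) , eq = boundSucc g eq
  labelled⇒succ tt (inj₁ ())
  labelled⇒succ tt (inj₂ (inj₁ ()))
  labelled⇒succ tt (inj₂ (inj₂ (_ , ())))
  labelled⇒succ ff (inj₁ ())
  labelled⇒succ ff (inj₂ (inj₁ ()))
  labelled⇒succ ff (inj₂ (inj₂ (_ , ())))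

  succ⇒labelled : ∀ {v w} → Edge E v w → Labelled v
  succ⇒labelled {_ ∧ _} _ = inj₁ refl
  succ⇒labelled {_ ∨ _} _ = inj₂ (inj₁ refl)
  succ⇒labelled {var _} (var-flat eq _ _) = inj₂ (inj₂ (bound⇒ranked E eq))
  succ⇒labelled {var _} (var-edge eq _)   = inj₂ (inj₂ (bound⇒ranked E eq))

  -- condition (iii): a variable with two distinct successors has a
  -- junction as right-hand side, so it is decorated ▲ or ▼
  branching : ∀ {v w₁ w₂} → Edge E v w₁ → Edge E v w₂ → w₁ ≢ w₂ → IsBranch (sgDeco E v)
  branching {_ ∧ _} _ _ _ = inj₁ refl
  branching {_ ∨ _} _ _ _ = inj₂ refl
  branching {var _} (var-flat {g = g} eq j _) _ _ =
    subst IsBranch (sym (boundDeco g eq)) (junction-branch g j)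
  branching {var _} (var-edge _ _) (var-flat {g = g} eq j _) _ =
    subst IsBranch (sym (boundDeco g eq)) (junction-branch g j)
  branching {var _} (var-edge eq _) (var-edge eq' _) w₁≢w₂ = ⊥-elim (w₁≢w₂ (rhs-unique E eq eq'))

lemma3p8 : (E : BES) → Unique (bnd E) → (f : Form) →
    IsFinite ⟨ E , f ⟩ × BESsy ⟨ E , f ⟩
lemma3p8 E _ f = finite , record
  { cond-i   = λ v _ leaf w e → leaf-sink e leaf
  ; cond-ii  = λ v _ → mk⇔ (labelled⇒succ v) (λ (_ , e) → succ⇒labelled e)
  ; cond-iii = λ v _ w₁ w₂ → branching
  ; cond-iv  = λ v vs _ → cycles-ranked ⟨ E , f ⟩ size ranked-or-shrinks
  }
  where
  open StructureGraphOf E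
  finite : IsFinite ⟨ E , f ⟩
  finite = finite-by-invariant ⟨ E , f ⟩ (Closure f) (subformulae f ++ rhsSubformulae E)
             (inj₁ sub-refl) closure-closed closure-listed
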